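{- (i) For an integer $n\geq 3$, let $\tau_{3}(n)$ be the number of triples of integers $(s,v,u)$ with $s\geq v>u\geq 0$ and $n+1=2^{s}+2^{v}+2^{u}$; let $\tau_{2}(n)$ be the number of pairs of non-negative integers $(s,u)$ with $n+1=2^{s}+2^{u}$; and let $\tau_{1}(n)$ be the number of non-negative integers $s$ with $n+1=2^{s}$. Then $$\mathrm{v}(2n)\equiv 2\tau_{3}(n)+\tau_{2}(n)+\tau_{1}(n)\pmod 4.$$ (ii) $\mathrm{v}(2^{k}-1)\equiv 3\pmod 4$ for every integer $k\geq 2$; $\mathrm{v}(2^{k}+2^{l}-1)\equiv 2\pmod 4$ for all integers $k>l\geq 1$; and for every odd integer $m\ge 3$ not of either of these two forms, $\mathrm{v}(m)\equiv 0\pmod 4$.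
   Context: For a positive integer $n$, $\mathrm{v}(n)$ denotes the number of compositions (ordered partitions) of $n$ into powers of $2$, i.e. the number of finite sequences $(q_1,\ldots,q_\ell)$ of non-negative integers with $n=2^{q_1}+\cdots+2^{q_\ell}$. -}

module Defs where

open import Data.Nat using (ℕ; zero; suc; _+_; _∸_; _^_; _≤_; _<_; _≤ᵇ_; _≟_; _≤?_; _<?_)
open import Data.Bool using (if_then_else_)
open import Data.List using (List; []; _∷_; [_]; map; concatMap; upTo; length; filter; cartesianProduct)
open import Data.Product using (_×_; _,_)
open import Relation.Binary.PropositionalEquality using (_≡_)
open import Relation.Nullary.Decidable using (_×-dec_)

-- compsF fuel n : the list of all compositions (q₁,…,qℓ) of n into powers of 2,
-- i.e. all lists of exponents with n = 2^q₁ + … + 2^qℓ, enumerated by first part.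
-- The fuel n is always sufficient (each part is ≥ 1); exponents q with 2^q ≤ n satisfy q < n.
compsF : ℕ → ℕ → List (List ℕ)
compsF _ zero = [ [] ]
compsF zero (suc _) = []
compsF (suc f) (suc m) =
  concatMap (λ q → if 2 ^ q ≤ᵇ suc m
                     then map (q ∷_) (compsF f (suc m ∸ 2 ^ q))
                     else [])
            (upTo (suc m))

compositions : ℕ → List (List ℕ)
compositions n = compsF n n

v : ℕ → ℕ
v n = length (compositions n)

-- ranges: any exponent s with 2^s ≤ n+1 satisfies s < n+2
range : ℕ → List ℕ
range n = upTo (n + 2)

τ₃ : ℕ → ℕ
τ₃ n = length (filter (λ { (s , (w , u)) → (w ≤? s) ×-dec ((u <? w) ×-dec (suc n ≟ 2 ^ s + 2 ^ w + 2 ^ u)) })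
                      (cartesianProduct (range n) (cartesianProduct (range n) (range n))))

τ₂ : ℕ → ℕ
τ₂ n = length (filter (λ { (s , u) → suc n ≟ 2 ^ s + 2 ^ u })
                      (cartesianProduct (range n) (range n)))

τ₁ : ℕ → ℕ
τ₁ n = length (filter (λ s → suc n ≟ 2 ^ s) (range n))

{-# OPTIONS --safe #-}
module Submission where

-- Splitting off the first part of a composition gives v(M) = Σₐ v(M − 2ᵃ); splitting off a second part
-- turns this into [M is a power of 2] + Σ_{a,b} v(M − 2ᵃ − 2ᵇ). The diagonal a = b of the double sum is
-- Σ_{a ≥ 1} v(M − 2ᵃ) = v(M) − v(M − 1), so that
--   v(N) = [N + 1 is a power of 2] + 2 Σ_{a>b} v(N + 1 − 2ᵃ − 2ᵇ).
-- Applying the same identity modulo 2 to the terms of the last sum gives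
--   v(N) ≡ rep₁(N + 1) + 2 rep₃(N + 2)  (mod 4),
-- where rep₁(t) counts the a with t = 2ᵃ and rep₃(t) the triples (a > b, c) with t = 2ᵃ + 2ᵇ + 2ᶜ.
-- Comparing parities halves the target of rep₃. For N = 2n the triples for n + 1 with c ≥ a are those
-- counted by τ₃, and the others are symmetric in b and c, so only their diagonal b = c counts mod 2.
-- For N = 2K − 1 one gets v(N) ≡ 3 rep₁(K) + 2 rep₂<(K) (mod 4), where rep₂<(K) counts the ways to
-- write K = 2ᵃ + 2ᵇ with a > b, and uniqueness of binary expansions evaluates both counts.

open import Defs
open import Data.Nat
  using (ℕ; zero; suc; _+_; _*_; _∸_; _^_; _≤_; _<_; _%_; z≤n; s≤s; z<s; s<s; _≤ᵇ_; _≟_; _≤?_; _<?_)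
open import Data.Nat.Properties
open import Data.Nat.DivMod using (_/_; m≡m%n+[m/n]*n; [m+kn]%n≡m%n; %-distribˡ-+)
open import Data.Nat.Logarithm using (⌊log₂_⌋; ⌊log₂[2^n]⌋≡n)
open import Data.Nat.ListAction using (sum)
open import Data.Nat.ListAction.Properties using (sum-++)
open import Data.Nat.Tactic.RingSolver using (solve-∀)
open import Data.Bool using (true; false; if_then_else_)
open import Data.List using (List; []; _∷_; _++_; map; concatMap; applyUpTo; upTo; length; filter; cartesianProduct)
open import Data.List.Properties using (length-++; length-map; concatMap-cong; map-cong; map-++; map-∘)
open import Data.Product using (_×_; _,_; proj₁; proj₂; Σ)
open import Data.Sum using (inj₁; inj₂)
open import Data.Empty using (⊥-elim)
open import Function using (_∘_)
open import Relation.Binary using (tri<; tri≈; tri>)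
open import Relation.Binary.PropositionalEquality
open ≡-Reasoning
open import Relation.Nullary using (¬_; Dec; yes; no; does; contradiction)
open import Relation.Nullary.Decidable using (_×-dec_)

private
  variable
    A A′ : Set

𝟙 : Dec A → ℕ
𝟙 d = if does d then 1 else 0

𝟙-yes : (d : Dec A) → A → 𝟙 d ≡ 1
𝟙-yes (yes _) _ = refl
𝟙-yes (no ¬p) p = ⊥-elim (¬p p)

𝟙-no : (d : Dec A) → ¬ A → 𝟙 d ≡ 0
𝟙-no (yes p) ¬p = ⊥-elim (¬p p)
𝟙-no (no _)  _  = refl

𝟙-⇔ : (d : Dec A) (e : Dec A′) → (A → A′) → (A′ → A) → 𝟙 d ≡ 𝟙 e
𝟙-⇔ (yes p) e f _ = sym (𝟙-yes e (f p))
𝟙-⇔ (no ¬p) e _ g = sym (𝟙-no e (¬p ∘ g))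

𝟙-×-dec : (d : Dec A) (e : Dec A′) → 𝟙 (d ×-dec e) ≡ 𝟙 d * 𝟙 e
𝟙-×-dec (yes _) e = sym (+-identityʳ (𝟙 e))
𝟙-×-dec (no _)  e = refl

𝟙-≤?+<? : ∀ a c → 𝟙 (a ≤? c) + 𝟙 (c <? a) ≡ 1
𝟙-≤?+<? a c with a ≤? c
... | yes a≤c = cong₂ _+_ (𝟙-yes (a ≤? c) a≤c) (𝟙-no (c <? a) (λ c<a → <⇒≱ c<a a≤c))
... | no a≰c  = cong₂ _+_ (𝟙-no (a ≤? c) a≰c) (𝟙-yes (c <? a) (≰⇒> a≰c))

∑< : ℕ → (ℕ → ℕ) → ℕ
∑< zero    f = 0
∑< (suc n) f = f 0 + ∑< n (λ i → f (suc i))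

infixr 8 ∑<
syntax ∑< n (λ i → e) = ∑[ i < n ] e

∑-cong-< : ∀ n {f g : ℕ → ℕ} → (∀ i → i < n → f i ≡ g i) → ∑< n f ≡ ∑< n g
∑-cong-< zero    _  = refl
∑-cong-< (suc n) eq = cong₂ _+_ (eq 0 z<s) (∑-cong-< n (λ i i<n → eq (suc i) (s<s i<n)))

∑-cong : ∀ n {f g : ℕ → ℕ} → (∀ i → f i ≡ g i) → ∑< n f ≡ ∑< n g
∑-cong n eq = ∑-cong-< n (λ i _ → eq i)

∑-zero : ∀ n {f : ℕ → ℕ} → (∀ i → i < n → f i ≡ 0) → ∑< n f ≡ 0
∑-zero zero    _  = refl
∑-zero (suc n) eq = cong₂ _+_ (eq 0 z<s) (∑-zero n (λ i i<n → eq (suc i) (s<s i<n)))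

∑-distrib-+ : ∀ n (f g : ℕ → ℕ) → ∑[ i < n ] (f i + g i) ≡ ∑< n f + ∑< n g
∑-distrib-+ zero    f g = refl
∑-distrib-+ (suc n) f g = begin
  (f 0 + g 0) + ∑[ i < n ] (f (suc i) + g (suc i))   ≡⟨ cong (f 0 + g 0 +_) (∑-distrib-+ n _ _) ⟩
  (f 0 + g 0) + (∑[ i < n ] f (suc i) + ∑[ i < n ] g (suc i)) ≡⟨ +-comm-middle (f 0) (g 0) _ _ ⟩
  (f 0 + ∑[ i < n ] f (suc i)) + (g 0 + ∑[ i < n ] g (suc i)) ∎
  where
    +-comm-middle : ∀ a b c d → (a + b) + (c + d) ≡ (a + c) + (b + d)
    +-comm-middle = solve-∀

∑-*-distribˡ : ∀ n k (f : ℕ → ℕ) → ∑[ i < n ] (k * f i) ≡ k * ∑< n f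
∑-*-distribˡ zero    k f = sym (*-zeroʳ k)
∑-*-distribˡ (suc n) k f =
  trans (cong (k * f 0 +_) (∑-*-distribˡ n k _)) (sym (*-distribˡ-+ k (f 0) _))

∑-last : ∀ n (f : ℕ → ℕ) → ∑< (suc n) f ≡ ∑< n f + f n
∑-last zero    f = +-comm (f 0) 0
∑-last (suc n) f = trans (cong (f 0 +_) (∑-last n _)) (sym (+-assoc (f 0) _ _))

∑-comm : ∀ m n (f : ℕ → ℕ → ℕ) → ∑[ i < m ] ∑[ j < n ] f i j ≡ ∑[ j < n ] ∑[ i < m ] f i j
∑-comm zero    n f = sym (∑-zero n (λ _ _ → refl))
∑-comm (suc m) n f =
  trans (cong (∑< n (f 0) +_) (∑-comm m n _)) (sym (∑-distrib-+ n (f 0) _))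

∑-extend : ∀ m k (f : ℕ → ℕ) → (∀ i → m ≤ i → f i ≡ 0) → ∑< (m + k) f ≡ ∑< m f
∑-extend zero    k f eq = ∑-zero k (λ i _ → eq i z≤n)
∑-extend (suc m) k f eq = cong (f 0 +_) (∑-extend m k _ (λ i m≤i → eq (suc i) (s≤s m≤i)))

∑-bound-irrelevant : ∀ m n (f : ℕ → ℕ) →
  (∀ i → m ≤ i → f i ≡ 0) → (∀ i → n ≤ i → f i ≡ 0) → ∑< m f ≡ ∑< n f
∑-bound-irrelevant m n f eqₘ eqₙ with ≤-total m n
... | inj₁ m≤n = sym (trans (cong (λ k → ∑< k f) (sym (m+[n∸m]≡n m≤n))) (∑-extend m _ f eqₘ))
... | inj₂ n≤m = trans (cong (λ k → ∑< k f) (sym (m+[n∸m]≡n n≤m))) (∑-extend n _ f eqₙ)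

∑-delta : ∀ n (f : ℕ → ℕ) i₀ → i₀ < n → (∀ i → i < n → i ≢ i₀ → f i ≡ 0) →
  ∑< n f ≡ f i₀
∑-delta (suc n) f zero    _         eq =
  trans (cong (f 0 +_) (∑-zero n (λ i i<n → eq (suc i) (s<s i<n) (λ ())))) (+-identityʳ (f 0))
∑-delta (suc n) f (suc i₀) (s<s i₀<n) eq =
  cong₂ _+_ (eq 0 z<s (λ ()))
            (∑-delta n _ i₀ i₀<n (λ i i<n i≢i₀ → eq (suc i) (s<s i<n) (i≢i₀ ∘ suc-injective)))

∑-symmetric : ∀ n (h : ℕ → ℕ → ℕ) → (∀ i j → h i j ≡ h j i) →
  ∑[ i < n ] ∑[ j < n ] h i j ≡ ∑[ i < n ] h i i + 2 * ∑[ i < n ] ∑[ j < i ] h i j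
∑-symmetric zero    h sym-h = refl
∑-symmetric (suc n) h sym-h = begin
    ∑[ i < suc n ] ∑[ j < suc n ] h i j
  ≡⟨ ∑-cong (suc n) (λ i → ∑-last n (h i)) ⟩
    ∑[ i < suc n ] (∑[ j < n ] h i j + h i n)
  ≡⟨ ∑-distrib-+ (suc n) (λ i → ∑< n (h i)) (λ i → h i n) ⟩
    ∑[ i < suc n ] ∑[ j < n ] h i j + ∑[ i < suc n ] h i n
  ≡⟨ cong₂ _+_ (∑-last n _) (∑-last n _) ⟩
    (∑[ i < n ] ∑[ j < n ] h i j + R) + (∑[ i < n ] h i n + h n n)
  ≡⟨ cong₂ (λ a b → (a + R) + (b + h n n)) (∑-symmetric n h sym-h) (∑-cong n (λ i → sym-h i n)) ⟩
    ((D + 2 * L) + R) + (R + h n n)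
  ≡⟨ regroup D L R (h n n) ⟩
    (D + h n n) + 2 * (L + R)
  ≡⟨ sym (cong₂ (λ a b → a + 2 * b) (∑-last n (λ i → h i i)) (∑-last n (λ i → ∑< i (h i)))) ⟩
    ∑[ i < suc n ] h i i + 2 * ∑[ i < suc n ] ∑[ j < i ] h i j
  ∎
  where
    D = ∑[ i < n ] h i i
    L = ∑[ i < n ] ∑[ j < i ] h i j
    R = ∑[ j < n ] h n j
    regroup : ∀ d l r x → ((d + 2 * l) + r) + (r + x) ≡ (d + x) + 2 * (l + r)
    regroup = solve-∀

∑-𝟙< : ∀ n i (f : ℕ → ℕ) → i ≤ n → ∑[ j < n ] (𝟙 (j <? i) * f j) ≡ ∑< i f
∑-𝟙< n       zero    f _         = ∑-zero n (λ _ _ → refl)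
∑-𝟙< (suc n) (suc i) f (s≤s i≤n) = cong₂ _+_ (+-identityʳ (f 0)) (begin
    ∑[ j < n ] (𝟙 (suc j <? suc i) * f (suc j))
  ≡⟨ ∑-cong n (λ j → cong (_* f (suc j)) (𝟙-⇔ (suc j <? suc i) (j <? i) ≤-pred s≤s)) ⟩
    ∑[ j < n ] (𝟙 (j <? i) * f (suc j))
  ≡⟨ ∑-𝟙< n i _ i≤n ⟩
    ∑[ j < i ] f (suc j)
  ∎)

∑-split-at : ∀ n i (f : ℕ → ℕ) → i ≤ n → ∑< n f ≡ ∑[ j < n ] (𝟙 (i ≤? j) * f j) + ∑< i f
∑-split-at n i f i≤n = begin
    ∑< n f
  ≡⟨ ∑-cong n (λ j → trans (sym (*-identityˡ (f j))) (cong (_* f j) (sym (𝟙-≤?+<? i j)))) ⟩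
    ∑[ j < n ] ((𝟙 (i ≤? j) + 𝟙 (j <? i)) * f j)
  ≡⟨ ∑-cong n (λ j → *-distribʳ-+ (f j) (𝟙 (i ≤? j)) (𝟙 (j <? i))) ⟩
    ∑[ j < n ] (𝟙 (i ≤? j) * f j + 𝟙 (j <? i) * f j)
  ≡⟨ ∑-distrib-+ n (λ j → 𝟙 (i ≤? j) * f j) (λ j → 𝟙 (j <? i) * f j) ⟩
    ∑[ j < n ] (𝟙 (i ≤? j) * f j) + ∑[ j < n ] (𝟙 (j <? i) * f j)
  ≡⟨ cong (∑[ j < n ] (𝟙 (i ≤? j) * f j) +_) (∑-𝟙< n i f i≤n) ⟩
    ∑[ j < n ] (𝟙 (i ≤? j) * f j) + ∑< i f
  ∎

[m+2n]%2≡m%2 : ∀ m n → (m + 2 * n) % 2 ≡ m % 2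
[m+2n]%2≡m%2 m n = trans (cong (λ k → (m + k) % 2) (*-comm 2 n)) ([m+kn]%n≡m%n m n 2)

[m+2n]%4≡[m+2[n%2]]%4 : ∀ m n → (m + 2 * n) % 4 ≡ (m + 2 * (n % 2)) % 4
[m+2n]%4≡[m+2[n%2]]%4 m n = begin
  (m + 2 * n) % 4                            ≡⟨ cong (λ k → (m + 2 * k) % 4) (m≡m%n+[m/n]*n n 2) ⟩
  (m + 2 * (n % 2 + n / 2 * 2)) % 4          ≡⟨ cong (_% 4) (regroup m (n % 2) (n / 2)) ⟩
  (m + 2 * (n % 2) + n / 2 * 4) % 4          ≡⟨ [m+kn]%n≡m%n (m + 2 * (n % 2)) (n / 2) 4 ⟩
  (m + 2 * (n % 2)) % 4                      ∎
  where
    regroup : ∀ m r q → m + 2 * (r + q * 2) ≡ m + 2 * r + q * 4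
    regroup = solve-∀

+2*-cong-%4 : ∀ m n o → n % 2 ≡ o % 2 → (m + 2 * n) % 4 ≡ (m + 2 * o) % 4
+2*-cong-%4 m n o n≡o = begin
  (m + 2 * n) % 4         ≡⟨ [m+2n]%4≡[m+2[n%2]]%4 m n ⟩
  (m + 2 * (n % 2)) % 4   ≡⟨ cong (λ k → (m + 2 * k) % 4) n≡o ⟩
  (m + 2 * (o % 2)) % 4   ≡⟨ [m+2n]%4≡[m+2[n%2]]%4 m o ⟨
  (m + 2 * o) % 4         ∎

∑-cong-%2 : ∀ n {f g : ℕ → ℕ} → (∀ i → f i % 2 ≡ g i % 2) → ∑< n f % 2 ≡ ∑< n g % 2
∑-cong-%2 zero    _  = refl
∑-cong-%2 (suc n) {f} {g} eq = begin
    (f 0 + ∑[ i < n ] f (suc i)) % 2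
  ≡⟨ %-distribˡ-+ (f 0) _ 2 ⟩
    (f 0 % 2 + (∑[ i < n ] f (suc i)) % 2) % 2
  ≡⟨ cong₂ (λ a b → (a + b) % 2) (eq 0) (∑-cong-%2 n (λ i → eq (suc i))) ⟩
    (g 0 % 2 + (∑[ i < n ] g (suc i)) % 2) % 2
  ≡⟨ %-distribˡ-+ (g 0) _ 2 ⟨
    (g 0 + ∑[ i < n ] g (suc i)) % 2
  ∎

𝟙-≟-even : ∀ {m n} m′ n′ → m ≡ 2 * m′ → n ≡ 2 * n′ → 𝟙 (m ≟ n) ≡ 𝟙 (m′ ≟ n′)
𝟙-≟-even {m} {n} m′ n′ refl refl = 𝟙-⇔ (m ≟ n) (m′ ≟ n′) (*-cancelˡ-≡ m′ n′ 2) (cong (2 *_))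

𝟙-≟-odd : ∀ {m n} m′ n′ → m ≡ suc (2 * m′) → n ≡ suc (2 * n′) →
  𝟙 (m ≟ n) ≡ 𝟙 (m′ ≟ n′)
𝟙-≟-odd {m} {n} m′ n′ refl refl =
  𝟙-⇔ (m ≟ n) (m′ ≟ n′) (*-cancelˡ-≡ m′ n′ 2 ∘ suc-injective) (cong (suc ∘ (2 *_)))

𝟙-≟-even-odd : ∀ {m n} m′ n′ → m ≡ 2 * m′ → n ≡ suc (2 * n′) → 𝟙 (m ≟ n) ≡ 0
𝟙-≟-even-odd {m} {n} m′ n′ refl refl = 𝟙-no (m ≟ n) (even≢odd m′ n′)

𝟙-≟-odd-even : ∀ {m n} m′ n′ → m ≡ suc (2 * m′) → n ≡ 2 * n′ → 𝟙 (m ≟ n) ≡ 0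
𝟙-≟-odd-even {m} {n} m′ n′ refl refl = 𝟙-no (m ≟ n) (even≢odd n′ m′ ∘ sym)

2^n+2^n≡2^[1+n] : ∀ n → 2 ^ n + 2 ^ n ≡ 2 ^ suc n
2^n+2^n≡2^[1+n] n = cong (2 ^ n +_) (sym (+-identityʳ (2 ^ n)))

n<2^n : ∀ n → n < 2 ^ n
n<2^n zero    = z<s
n<2^n (suc n) = ≤-<-trans (n<2^n n) (subst (2 ^ n <_) (2^n+2^n≡2^[1+n] n) (m<m+n (2 ^ n) (m^n>0 2 n)))

2≤2^[1+j] : ∀ j → 2 ≤ 2 ^ suc j
2≤2^[1+j] j = ^-monoʳ-≤ 2 {1} {suc j} (s≤s z≤n)

2^-injective : ∀ {a b} → 2 ^ a ≡ 2 ^ b → a ≡ b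
2^-injective {a} {b} eq = begin
  a                 ≡⟨ ⌊log₂[2^n]⌋≡n a ⟨
  ⌊log₂ (2 ^ a) ⌋   ≡⟨ cong ⌊log₂_⌋ eq ⟩
  ⌊log₂ (2 ^ b) ⌋   ≡⟨ ⌊log₂[2^n]⌋≡n b ⟩
  b                 ∎

private
  2^[1+a]+1≡1+2*2^a : ∀ a → 2 ^ suc a + 1 ≡ suc (2 * 2 ^ a)
  2^[1+a]+1≡1+2*2^a a = +-comm (2 ^ suc a) 1

  2^[1+a]+2^[1+b]≡2[2^a+2^b] : ∀ a b → 2 ^ suc a + 2 ^ suc b ≡ 2 * (2 ^ a + 2 ^ b)
  2^[1+a]+2^[1+b]≡2[2^a+2^b] a b = sym (*-distribˡ-+ 2 (2 ^ a) (2 ^ b))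

2^a+2^b≢2^c : ∀ {a b} c → b < a → 2 ^ a + 2 ^ b ≢ 2 ^ c
2^a+2^b≢2^c {suc a} {zero}  zero    _ eq =
  <⇒≢ (m^n>0 2 (suc a)) (sym (+-cancelʳ-≡ 1 (2 ^ suc a) 0 eq))
2^a+2^b≢2^c {suc a} {zero}  (suc c) _ eq =
  even≢odd (2 ^ c) (2 ^ a) (sym (trans (sym (2^[1+a]+1≡1+2*2^a a)) eq))
2^a+2^b≢2^c {suc a} {suc b} zero    _ eq =
  even≢odd (2 ^ a + 2 ^ b) 0 (trans (sym (2^[1+a]+2^[1+b]≡2[2^a+2^b] a b)) eq)
2^a+2^b≢2^c {suc a} {suc b} (suc c) (s<s b<a) eq =
  2^a+2^b≢2^c c b<a (*-cancelˡ-≡ _ _ 2 (trans (sym (2^[1+a]+2^[1+b]≡2[2^a+2^b] a b)) eq))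

2^a+2^b-injective : ∀ {a b c d} → b < a → d < c → 2 ^ a + 2 ^ b ≡ 2 ^ c + 2 ^ d → a ≡ c × b ≡ d
2^a+2^b-injective {a}     {zero}  {c}     {zero}  _ _ eq = 2^-injective (+-cancelʳ-≡ 1 (2 ^ a) (2 ^ c) eq) , refl
2^a+2^b-injective {suc a} {zero}  {suc c} {suc d} _ _ eq =
  contradiction (trans (sym (2^[1+a]+2^[1+b]≡2[2^a+2^b] c d)) (trans (sym eq) (2^[1+a]+1≡1+2*2^a a)))
                (even≢odd (2 ^ c + 2 ^ d) (2 ^ a))
2^a+2^b-injective {suc a} {suc b} {suc c} {zero}  _ _ eq =
  contradiction (trans (sym (2^[1+a]+2^[1+b]≡2[2^a+2^b] a b)) (trans eq (2^[1+a]+1≡1+2*2^a c)))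
                (even≢odd (2 ^ a + 2 ^ b) (2 ^ c))
2^a+2^b-injective {suc a} {suc b} {suc c} {suc d} (s<s b<a) (s<s d<c) eq
  with 2^a+2^b-injective b<a d<c (*-cancelˡ-≡ _ _ 2
         (trans (sym (2^[1+a]+2^[1+b]≡2[2^a+2^b] a b)) (trans eq (2^[1+a]+2^[1+b]≡2[2^a+2^b] c d))))
... | refl , refl = refl , refl

length-concatMap : (f : A → List A′) (xs : List A) →
  length (concatMap f xs) ≡ sum (map (length ∘ f) xs)
length-concatMap f []       = refl
length-concatMap f (x ∷ xs) = trans (length-++ (f x)) (cong (length (f x) +_) (length-concatMap f xs))

length-filter≡sum-𝟙 : {P : A → Set} (P? : ∀ x → Dec (P x)) (xs : List A) →
  length (filter P? xs) ≡ sum (map (𝟙 ∘ P?) xs)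
length-filter≡sum-𝟙 P? []       = refl
length-filter≡sum-𝟙 P? (x ∷ xs) with does (P? x)
... | true  = cong suc (length-filter≡sum-𝟙 P? xs)
... | false = length-filter≡sum-𝟙 P? xs

sum-map-cartesianProduct : (f : A × A′ → ℕ) (xs : List A) (ys : List A′) →
  sum (map f (cartesianProduct xs ys)) ≡ sum (map (λ x → sum (map (λ y → f (x , y)) ys)) xs)
sum-map-cartesianProduct f []       ys = refl
sum-map-cartesianProduct f (x ∷ xs) ys = begin
    sum (map f (map (x ,_) ys ++ cartesianProduct xs ys))
  ≡⟨ cong sum (map-++ f (map (x ,_) ys) _) ⟩
    sum (map f (map (x ,_) ys) ++ map f (cartesianProduct xs ys))
  ≡⟨ sum-++ (map f (map (x ,_) ys)) _ ⟩
    sum (map f (map (x ,_) ys)) + sum (map f (cartesianProduct xs ys))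
  ≡⟨ cong₂ _+_ (cong sum (sym (map-∘ ys))) (sum-map-cartesianProduct f xs ys) ⟩
    sum (map (λ y → f (x , y)) ys) + sum (map (λ x → sum (map (λ y → f (x , y)) ys)) xs)
  ∎

sum-map-applyUpTo : (f g : ℕ → ℕ) (n : ℕ) → sum (map f (applyUpTo g n)) ≡ ∑[ i < n ] f (g i)
sum-map-applyUpTo f g zero    = refl
sum-map-applyUpTo f g (suc n) = cong (f (g 0) +_) (sum-map-applyUpTo f (g ∘ suc) n)

sum-map-upTo : (f : ℕ → ℕ) (n : ℕ) → sum (map f (upTo n)) ≡ ∑< n f
sum-map-upTo f = sum-map-applyUpTo f (λ i → i)

sum-map-upTo² : ∀ m (f : ℕ → ℕ → ℕ) →
  sum (map (λ (i , j) → f i j) (cartesianProduct (upTo m) (upTo m))) ≡ ∑[ i < m ] ∑[ j < m ] f i j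
sum-map-upTo² m f = begin
    sum (map (λ (i , j) → f i j) (cartesianProduct (upTo m) (upTo m)))
  ≡⟨ sum-map-cartesianProduct (λ (i , j) → f i j) (upTo m) (upTo m) ⟩
    sum (map (λ i → sum (map (f i) (upTo m))) (upTo m))
  ≡⟨ cong sum (map-cong (λ i → sum-map-upTo (f i) m) (upTo m)) ⟩
    sum (map (λ i → ∑< m (f i)) (upTo m))
  ≡⟨ sum-map-upTo (λ i → ∑< m (f i)) m ⟩
    ∑[ i < m ] ∑[ j < m ] f i j
  ∎

sum-map-upTo³ : ∀ m (f : ℕ → ℕ → ℕ → ℕ) →
  sum (map (λ (i , j , k) → f i j k) (cartesianProduct (upTo m) (cartesianProduct (upTo m) (upTo m))))
  ≡ ∑[ i < m ] ∑[ j < m ] ∑[ k < m ] f i j k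
sum-map-upTo³ m f = begin
    sum (map (λ (i , j , k) → f i j k) (cartesianProduct (upTo m) (cartesianProduct (upTo m) (upTo m))))
  ≡⟨ sum-map-cartesianProduct (λ (i , j , k) → f i j k) (upTo m) (cartesianProduct (upTo m) (upTo m)) ⟩
    sum (map (λ i → sum (map (λ (j , k) → f i j k) (cartesianProduct (upTo m) (upTo m)))) (upTo m))
  ≡⟨ cong sum (map-cong (λ i → sum-map-upTo² m (f i)) (upTo m)) ⟩
    sum (map (λ i → ∑[ j < m ] ∑[ k < m ] f i j k) (upTo m))
  ≡⟨ sum-map-upTo (λ i → ∑[ j < m ] ∑[ k < m ] f i j k) m ⟩
    ∑[ i < m ] ∑[ j < m ] ∑[ k < m ] f i j k
  ∎

-- Splitting off parts of a composition

1+m∸2^q≤m : ∀ m q → suc m ∸ 2 ^ q ≤ m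
1+m∸2^q≤m m q = ∸-monoʳ-≤ (suc m) (m^n>0 2 q)

compsF-fuel-irrelevant : ∀ f g k → k ≤ f → k ≤ g → compsF f k ≡ compsF g k
compsF-fuel-irrelevant _       _       zero    _         _         = refl
compsF-fuel-irrelevant (suc f) (suc g) (suc m) (s≤s m≤f) (s≤s m≤g) =
  concatMap-cong (λ q → cong (λ cs → if 2 ^ q ≤ᵇ suc m then map (q ∷_) cs else [])
                             (compsF-fuel-irrelevant f g _ (≤-trans (1+m∸2^q≤m m q) m≤f)
                                                            (≤-trans (1+m∸2^q≤m m q) m≤g)))
                 (upTo (suc m))

-- v (M − x); the indicator replaces the junk value v (M ∸ x) = v 0 = 1 by 0 when x > M.
vRest : ℕ → ℕ → ℕ
vRest M x = 𝟙 (x ≤? M) * v (M ∸ x)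

vRest-≤ : ∀ {M x} → x ≤ M → vRest M x ≡ v (M ∸ x)
vRest-≤ {M} {x} x≤M = trans (cong (_* v (M ∸ x)) (𝟙-yes (x ≤? M) x≤M)) (+-identityʳ _)

vRest-> : ∀ {M x} → M < x → vRest M x ≡ 0
vRest-> {M} {x} M<x = cong (_* v (M ∸ x)) (𝟙-no (x ≤? M) (<⇒≱ M<x))

vRest-∸ : ∀ {M x} y → x ≤ M → vRest (M ∸ x) y ≡ vRest M (x + y)
vRest-∸ {M} {x} y x≤M = cong₂ _*_
  (𝟙-⇔ (y ≤? M ∸ x) (x + y ≤? M)
       (λ y≤M∸x → subst (_≤ M) (+-comm y x) (m≤o∸n⇒m+n≤o y x≤M y≤M∸x))
       (λ x+y≤M → m+n≤o⇒m≤o∸n y (subst (_≤ M) (+-comm x y) x+y≤M)))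
  (cong v (∸-+-assoc M x y))

v-suc : ∀ m → v (suc m) ≡ ∑[ q < suc m ] vRest (suc m) (2 ^ q)
v-suc m = begin
    length (concatMap part (upTo (suc m)))
  ≡⟨ length-concatMap part (upTo (suc m)) ⟩
    sum (map (length ∘ part) (upTo (suc m)))
  ≡⟨ sum-map-upTo (length ∘ part) (suc m) ⟩
    ∑[ q < suc m ] length (part q)
  ≡⟨ ∑-cong (suc m) length-part ⟩
    ∑[ q < suc m ] vRest (suc m) (2 ^ q)
  ∎
  where
    part : ℕ → List (List ℕ)
    part q = if 2 ^ q ≤ᵇ suc m then map (q ∷_) (compsF m (suc m ∸ 2 ^ q)) else []
    length-part : ∀ q → length (part q) ≡ vRest (suc m) (2 ^ q)
    length-part q with 2 ^ q ≤ᵇ suc m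
    ... | true  = trans (length-map (q ∷_) (compsF m (suc m ∸ 2 ^ q)))
                  (trans (cong length (compsF-fuel-irrelevant m _ _ (1+m∸2^q≤m m q) ≤-refl))
                         (sym (+-identityʳ _)))
    ... | false = refl

v-first-part : ∀ K B → 0 < K → K < 2 ^ B → v K ≡ ∑[ q < B ] vRest K (2 ^ q)
v-first-part (suc m) B _ K<2^B = trans (v-suc m) (∑-bound-irrelevant (suc m) B _
  (λ q m<q → vRest-> (≤-<-trans m<q (n<2^n q)))
  (λ q B≤q → vRest-> (<-≤-trans K<2^B (^-monoʳ-≤ 2 B≤q))))

∑-vRest-beyond : ∀ {M x} B → M ≤ x → ∑[ b < B ] vRest M (x + 2 ^ b) ≡ 0
∑-vRest-beyond {M} {x} B M≤x = ∑-zero B (λ b _ → vRest-> (≤-<-trans M≤x (m<m+n x (m^n>0 2 b))))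

vRest-next-part : ∀ M B x → M < 2 ^ B → vRest M x ≡ 𝟙 (M ≟ x) + ∑[ b < B ] vRest M (x + 2 ^ b)
vRest-next-part M B x M<2^B with <-cmp M x
... | tri< M<x _ _ = begin
    vRest M x                                   ≡⟨ vRest-> M<x ⟩
    0 + 0                                       ≡⟨ cong₂ _+_ (𝟙-no (M ≟ x) (<⇒≢ M<x))
                                                             (∑-vRest-beyond B (<⇒≤ M<x)) ⟨
    𝟙 (M ≟ x) + ∑[ b < B ] vRest M (x + 2 ^ b)  ∎
... | tri≈ _ refl _ = begin
    vRest M M                                   ≡⟨ vRest-≤ {M} ≤-refl ⟩
    v (M ∸ M)                                   ≡⟨ cong v (n∸n≡0 M) ⟩
    1 + 0                                       ≡⟨ cong₂ _+_ (𝟙-yes (M ≟ M) refl)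
                                                             (∑-vRest-beyond {M} B ≤-refl) ⟨
    𝟙 (M ≟ M) + ∑[ b < B ] vRest M (M + 2 ^ b)  ∎
... | tri> _ _ x<M = begin
    vRest M x                                   ≡⟨ vRest-≤ (<⇒≤ x<M) ⟩
    v (M ∸ x)                                   ≡⟨ v-first-part (M ∸ x) B (m<n⇒0<n∸m x<M) M∸x<2^B ⟩
    ∑[ b < B ] vRest (M ∸ x) (2 ^ b)            ≡⟨ ∑-cong B (λ b → vRest-∸ (2 ^ b) (<⇒≤ x<M)) ⟩
    0 + S                                       ≡⟨ cong (_+ S) (𝟙-no (M ≟ x) (>⇒≢ x<M)) ⟨
    𝟙 (M ≟ x) + S                               ∎
  where
    S = ∑[ b < B ] vRest M (x + 2 ^ b)
    M∸x<2^B : M ∸ x < 2 ^ B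
    M∸x<2^B = ≤-<-trans (m∸n≤m M x) M<2^B

-- Representations by powers of two, and v modulo 4

-- Exponents range below a bound B, which is immaterial once 2 ^ B exceeds the target t.
rep₁ : ℕ → ℕ → ℕ
rep₁ B t = ∑[ a < B ] 𝟙 (t ≟ 2 ^ a)

rep₂ : ℕ → ℕ → ℕ
rep₂ B t = ∑[ a < B ] ∑[ b < B ] 𝟙 (t ≟ 2 ^ a + 2 ^ b)

rep₂< : ℕ → ℕ → ℕ
rep₂< B t = ∑[ a < B ] ∑[ b < a ] 𝟙 (t ≟ 2 ^ a + 2 ^ b)

rep₃ : ℕ → ℕ → ℕ
rep₃ B t = ∑[ a < B ] ∑[ b < a ] ∑[ c < B ] 𝟙 (t ≟ 2 ^ a + 2 ^ b + 2 ^ c)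

rep₃< : ℕ → ℕ → ℕ
rep₃< B t = ∑[ a < B ] ∑[ b < a ] ∑[ c < b ] 𝟙 (t ≟ 2 ^ a + 2 ^ b + 2 ^ c)

rep₃≥ : ℕ → ℕ → ℕ
rep₃≥ B t = ∑[ w < B ] ∑[ s < B ] (𝟙 (w ≤? s) * ∑[ u < w ] 𝟙 (t ≟ 2 ^ s + 2 ^ w + 2 ^ u))

vPairs : ℕ → ℕ → ℕ
vPairs B M = ∑[ a < B ] ∑[ b < a ] vRest M (2 ^ a + 2 ^ b)

-- The diagonal a = b of the double sum reproduces the terms a ≥ 1 of the single sum; they cancel and
-- leave its term a = 0, which is v N.
v≡rep₁+2*vPairs : ∀ N B → suc N < 2 ^ B → v N ≡ rep₁ B (suc N) + 2 * vPairs B (suc N)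
v≡rep₁+2*vPairs N zero    (s≤s ())
v≡rep₁+2*vPairs N (suc B) M<2^B = +-cancelʳ-≡ S (v N) _ (begin
    v N + S
  ≡⟨ cong (_+ S) (sym (vRest-≤ {M} (s≤s z≤n))) ⟩
    ∑[ a < suc B ] vRest M (2 ^ a)
  ≡⟨ ∑-cong (suc B) (λ a → vRest-next-part M (suc B) (2 ^ a) M<2^B) ⟩
    ∑[ a < suc B ] (𝟙 (M ≟ 2 ^ a) + ∑[ b < suc B ] H a b)
  ≡⟨ ∑-distrib-+ (suc B) (λ a → 𝟙 (M ≟ 2 ^ a)) (λ a → ∑[ b < suc B ] H a b) ⟩
    rep₁ (suc B) M + ∑[ a < suc B ] ∑[ b < suc B ] H a b
  ≡⟨ cong (rep₁ (suc B) M +_) (∑-symmetric (suc B) H (λ a b → cong (vRest M) (+-comm (2 ^ a) (2 ^ b)))) ⟩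
    rep₁ (suc B) M + (∑[ a < suc B ] H a a + 2 * T)
  ≡⟨ cong (λ d → rep₁ (suc B) M + (d + 2 * T)) diagonal ⟩
    rep₁ (suc B) M + (S + 2 * T)
  ≡⟨ move-right (rep₁ (suc B) M) S T ⟩
    rep₁ (suc B) M + 2 * T + S
  ∎)
  where
    M = suc N
    H : ℕ → ℕ → ℕ
    H a b = vRest M (2 ^ a + 2 ^ b)
    S = ∑[ a < B ] vRest M (2 ^ suc a)
    T = vPairs (suc B) M
    diagonal : ∑[ a < suc B ] H a a ≡ S
    diagonal = begin
      ∑[ a < suc B ] H a a      ≡⟨ ∑-last B (λ a → H a a) ⟩
      ∑[ a < B ] H a a + H B B  ≡⟨ cong₂ _+_ (∑-cong B (λ a → cong (vRest M) (2^n+2^n≡2^[1+n] a)))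
                                             (vRest-> (subst (M <_) (sym (2^n+2^n≡2^[1+n] B)) M<2^B)) ⟩
      S + 0                     ≡⟨ +-identityʳ S ⟩
      S                         ∎
    move-right : ∀ r s t → r + (s + 2 * t) ≡ r + 2 * t + s
    move-right = solve-∀

v-parity : ∀ N B → suc N < 2 ^ B → v N % 2 ≡ rep₁ B (suc N) % 2
v-parity N B lt =
  trans (cong (_% 2) (v≡rep₁+2*vPairs N B lt)) ([m+2n]%2≡m%2 (rep₁ B (suc N)) (vPairs B (suc N)))

vRest-parity : ∀ M B x → suc M < 2 ^ B → vRest M x % 2 ≡ (∑[ c < B ] 𝟙 (suc M ≟ x + 2 ^ c)) % 2
vRest-parity M B x M<2^B with x ≤? M
... | yes x≤M = begin
    vRest M x % 2
  ≡⟨ cong (_% 2) (vRest-≤ {M} x≤M) ⟩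
    v (M ∸ x) % 2
  ≡⟨ v-parity (M ∸ x) B (≤-<-trans (s≤s (m∸n≤m M x)) M<2^B) ⟩
    rep₁ B (suc (M ∸ x)) % 2
  ≡⟨ cong (_% 2) (∑-cong B (λ c → 𝟙-⇔ (suc (M ∸ x) ≟ 2 ^ c) (suc M ≟ x + 2 ^ c) (to c) (from c))) ⟩
    (∑[ c < B ] 𝟙 (suc M ≟ x + 2 ^ c)) % 2
  ∎
  where
    suc[M∸x] : suc (M ∸ x) ≡ suc M ∸ x
    suc[M∸x] = sym (+-∸-assoc 1 x≤M)
    to : ∀ c → suc (M ∸ x) ≡ 2 ^ c → suc M ≡ x + 2 ^ c
    to c eq = trans (sym (m+[n∸m]≡n (m≤n⇒m≤1+n x≤M))) (cong (x +_) (trans (sym suc[M∸x]) eq))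
    from : ∀ c → suc M ≡ x + 2 ^ c → suc (M ∸ x) ≡ 2 ^ c
    from c eq = trans suc[M∸x] (trans (cong (_∸ x) eq) (m+n∸m≡n x (2 ^ c)))
... | no x≰M = begin
    vRest M x % 2
  ≡⟨ cong (_% 2) (vRest-> (≰⇒> x≰M)) ⟩
    0
  ≡⟨ cong (_% 2) (∑-zero B (λ c _ → 𝟙-no (suc M ≟ x + 2 ^ c) (suc-M≢x+2^c c))) ⟨
    (∑[ c < B ] 𝟙 (suc M ≟ x + 2 ^ c)) % 2
  ∎
  where
    suc-M≢x+2^c : ∀ c → suc M ≢ x + 2 ^ c
    suc-M≢x+2^c c eq = <-irrefl eq (≤-<-trans (≰⇒> x≰M) (m<m+n x (m^n>0 2 c)))

v-mod4 : ∀ N B → suc (suc N) < 2 ^ B → v N % 4 ≡ (rep₁ B (suc N) + 2 * rep₃ B (suc (suc N))) % 4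
v-mod4 N B lt = trans (cong (_% 4) (v≡rep₁+2*vPairs N B (<-trans (n<1+n (suc N)) lt)))
  (+2*-cong-%4 (rep₁ B (suc N)) (vPairs B (suc N)) (rep₃ B (suc (suc N)))
    (∑-cong-%2 B (λ a → ∑-cong-%2 a (λ b → vRest-parity (suc N) B (2 ^ a + 2 ^ b) lt))))

-- Halving the target

private
  2p+1+1≡2[p+1] : ∀ p → 2 * p + 1 + 1 ≡ 2 * (p + 1)
  2p+1+1≡2[p+1] = solve-∀
  2p+1+2q≡1+2[p+q] : ∀ p q → 2 * p + 1 + 2 * q ≡ suc (2 * (p + q))
  2p+1+2q≡1+2[p+q] = solve-∀
  2p+2q+1≡1+2[p+q] : ∀ p q → 2 * p + 2 * q + 1 ≡ suc (2 * (p + q))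
  2p+2q+1≡1+2[p+q] = solve-∀
  2p+2q+2r≡2[p+q+r] : ∀ p q r → 2 * p + 2 * q + 2 * r ≡ 2 * (p + q + r)
  2p+2q+2r≡2[p+q+r] = solve-∀

rep₁-even : ∀ B t → rep₁ (suc B) (2 * t) ≡ rep₁ B t
rep₁-even B t =
  cong₂ _+_ (𝟙-≟-even-odd t 0 refl refl) (∑-cong B (λ a → 𝟙-≟-even t (2 ^ a) refl refl))

rep₁-odd : ∀ B t → 0 < t → rep₁ B (suc (2 * t)) ≡ 0
rep₁-odd zero    t _   = refl
rep₁-odd (suc B) t 0<t = cong₂ _+_
  (𝟙-no (suc (2 * t) ≟ 1) (λ eq → <⇒≢ 0<t (sym (*-cancelˡ-≡ t 0 2 (suc-injective eq)))))
  (∑-zero B (λ a _ → 𝟙-≟-odd-even t (2 ^ a) refl refl))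

rep₁-shift : ∀ B t → t ≢ 1 → t ≢ 2 ^ B → ∑[ a < B ] 𝟙 (t ≟ 2 ^ suc a) ≡ rep₁ B t
rep₁-shift zero    t _   _    = refl
rep₁-shift (suc B) t t≢1 t≢2^B = begin
  ∑[ a < suc B ] 𝟙 (t ≟ 2 ^ suc a)   ≡⟨ ∑-last B (λ a → 𝟙 (t ≟ 2 ^ suc a)) ⟩
  S + 𝟙 (t ≟ 2 ^ suc B)              ≡⟨ cong (S +_) (𝟙-no (t ≟ 2 ^ suc B) t≢2^B) ⟩
  S + 0                              ≡⟨ +-comm S 0 ⟩
  0 + S                              ≡⟨ cong (_+ S) (𝟙-no (t ≟ 1) t≢1) ⟨
  rep₁ (suc B) t                     ∎
  where
    S = ∑[ a < B ] 𝟙 (t ≟ 2 ^ suc a)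

rep₂-symmetric : ∀ B t → rep₂ B t ≡ ∑[ a < B ] 𝟙 (t ≟ 2 ^ suc a) + 2 * rep₂< B t
rep₂-symmetric B t = trans
  (∑-symmetric B (λ a b → 𝟙 (t ≟ 2 ^ a + 2 ^ b))
                 (λ a b → cong (λ s → 𝟙 (t ≟ s)) (+-comm (2 ^ a) (2 ^ b))))
  (cong (_+ 2 * rep₂< B t) (∑-cong B (λ a → cong (λ s → 𝟙 (t ≟ s)) (2^n+2^n≡2^[1+n] a))))

rep₃-even : ∀ B t → rep₃ (suc B) (2 * t) ≡ ∑[ a < B ] 𝟙 (t ≟ 2 ^ a + 1) + rep₃ B t
rep₃-even B t = trans (∑-cong B (λ a → cong₂ _+_ (b-zero a) (∑-cong a (b-suc a))))
  (∑-distrib-+ B (λ a → 𝟙 (t ≟ 2 ^ a + 1)) (λ a → ∑[ b < a ] ∑[ c < B ] 𝟙 (t ≟ 2 ^ a + 2 ^ b + 2 ^ c)))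
  where
    b-zero : ∀ a → ∑[ c < suc B ] 𝟙 (2 * t ≟ 2 ^ suc a + 1 + 2 ^ c) ≡ 𝟙 (t ≟ 2 ^ a + 1)
    b-zero a = trans (cong₂ _+_
      (𝟙-≟-even t (2 ^ a + 1) refl (2p+1+1≡2[p+1] (2 ^ a)))
      (∑-zero B (λ c _ → 𝟙-≟-even-odd t (2 ^ a + 2 ^ c) refl (2p+1+2q≡1+2[p+q] (2 ^ a) (2 ^ c)))))
      (+-identityʳ _)
    b-suc : ∀ a b →
      ∑[ c < suc B ] 𝟙 (2 * t ≟ 2 ^ suc a + 2 ^ suc b + 2 ^ c) ≡ ∑[ c < B ] 𝟙 (t ≟ 2 ^ a + 2 ^ b + 2 ^ c)
    b-suc a b = cong₂ _+_
      (𝟙-≟-even-odd t (2 ^ a + 2 ^ b) refl (2p+2q+1≡1+2[p+q] (2 ^ a) (2 ^ b)))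
      (∑-cong B (λ c → 𝟙-≟-even t (2 ^ a + 2 ^ b + 2 ^ c) refl (2p+2q+2r≡2[p+q+r] (2 ^ a) (2 ^ b) (2 ^ c))))

rep₃-odd : ∀ B t → rep₃ (suc B) (suc (2 * t)) ≡ rep₂ B t + rep₂< B t
rep₃-odd B t = trans (∑-cong B (λ a → cong₂ _+_ (b-zero a) (∑-cong a (b-suc a))))
  (∑-distrib-+ B (λ a → ∑[ c < B ] 𝟙 (t ≟ 2 ^ a + 2 ^ c)) (λ a → ∑[ b < a ] 𝟙 (t ≟ 2 ^ a + 2 ^ b)))
  where
    b-zero : ∀ a →
      ∑[ c < suc B ] 𝟙 (suc (2 * t) ≟ 2 ^ suc a + 1 + 2 ^ c) ≡ ∑[ c < B ] 𝟙 (t ≟ 2 ^ a + 2 ^ c)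
    b-zero a = cong₂ _+_
      (𝟙-≟-odd-even t (2 ^ a + 1) refl (2p+1+1≡2[p+1] (2 ^ a)))
      (∑-cong B (λ c → 𝟙-≟-odd t (2 ^ a + 2 ^ c) refl (2p+1+2q≡1+2[p+q] (2 ^ a) (2 ^ c))))
    b-suc : ∀ a b → ∑[ c < suc B ] 𝟙 (suc (2 * t) ≟ 2 ^ suc a + 2 ^ suc b + 2 ^ c) ≡ 𝟙 (t ≟ 2 ^ a + 2 ^ b)
    b-suc a b = trans (cong₂ _+_
      (𝟙-≟-odd t (2 ^ a + 2 ^ b) refl (2p+2q+1≡1+2[p+q] (2 ^ a) (2 ^ b)))
      (∑-zero B (λ c _ →
        𝟙-≟-odd-even t (2 ^ a + 2 ^ b + 2 ^ c) refl (2p+2q+2r≡2[p+q+r] (2 ^ a) (2 ^ b) (2 ^ c)))))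
      (+-identityʳ _)

rep₃-split : ∀ B t →
  rep₃ B t ≡ rep₃≥ B t + (∑[ a < B ] ∑[ b < a ] 𝟙 (t ≟ 2 ^ a + 2 ^ suc b) + 2 * rep₃< B t)
rep₃-split B t = begin
    ∑[ a < B ] ∑[ b < a ] ∑[ c < B ] triple a b c
  ≡⟨ ∑-cong-< B (λ a a<B → trans (∑-cong a (λ b → ∑-split-at B a (triple a b) (<⇒≤ a<B)))
                                  (∑-distrib-+ a (upper a) (λ b → ∑[ c < a ] triple a b c))) ⟩
    ∑[ a < B ] (∑[ b < a ] upper a b + ∑[ b < a ] ∑[ c < a ] triple a b c)
  ≡⟨ ∑-distrib-+ B (λ a → ∑[ b < a ] upper a b) (λ a → ∑[ b < a ] ∑[ c < a ] triple a b c) ⟩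
    ∑[ a < B ] ∑[ b < a ] upper a b + ∑[ a < B ] ∑[ b < a ] ∑[ c < a ] triple a b c
  ≡⟨ cong₂ _+_ (∑-cong B largest-part-first) (∑-cong B pair-symmetric) ⟩
    rep₃≥ B t + ∑[ a < B ] (diagonal a + 2 * lower a)
  ≡⟨ cong (rep₃≥ B t +_) (trans (∑-distrib-+ B diagonal (λ a → 2 * lower a))
                                (cong (∑< B diagonal +_) (∑-*-distribˡ B 2 lower))) ⟩
    rep₃≥ B t + (∑[ a < B ] ∑[ b < a ] 𝟙 (t ≟ 2 ^ a + 2 ^ suc b) + 2 * rep₃< B t)
  ∎
  where
    triple : ℕ → ℕ → ℕ → ℕ
    triple a b c = 𝟙 (t ≟ 2 ^ a + 2 ^ b + 2 ^ c)
    upper : ℕ → ℕ → ℕ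
    diagonal lower : ℕ → ℕ
    upper a b  = ∑[ c < B ] (𝟙 (a ≤? c) * triple a b c)
    diagonal a = ∑[ b < a ] 𝟙 (t ≟ 2 ^ a + 2 ^ suc b)
    lower a    = ∑[ b < a ] ∑[ c < b ] triple a b c
    largest-part-first : ∀ a → ∑[ b < a ] upper a b ≡ ∑[ c < B ] (𝟙 (a ≤? c) * ∑[ b < a ] triple c a b)
    largest-part-first a = trans (∑-comm a B (λ b c → 𝟙 (a ≤? c) * triple a b c)) (∑-cong B (λ c → trans
      (∑-*-distribˡ a (𝟙 (a ≤? c)) (λ b → triple a b c))
      (cong (𝟙 (a ≤? c) *_) (∑-cong a (λ b → cong (λ s → 𝟙 (t ≟ s)) (rotate (2 ^ a) (2 ^ b) (2 ^ c)))))))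
      where
        rotate : ∀ x y z → x + y + z ≡ z + x + y
        rotate = solve-∀
    pair-symmetric : ∀ a → ∑[ b < a ] ∑[ c < a ] triple a b c ≡ diagonal a + 2 * lower a
    pair-symmetric a = trans
      (∑-symmetric a (triple a) (λ b c → cong (λ s → 𝟙 (t ≟ s)) (swap-last (2 ^ a) (2 ^ b) (2 ^ c))))
      (cong (_+ 2 * lower a) (∑-cong a (λ b → cong (λ s → 𝟙 (t ≟ s))
        (trans (+-assoc (2 ^ a) (2 ^ b) (2 ^ b)) (cong (2 ^ a +_) (2^n+2^n≡2^[1+n] b))))))
      where
        swap-last : ∀ x y z → x + y + z ≡ x + z + y
        swap-last = solve-∀

pairs≥-by-lowest≡by-diagonal : ∀ B t →
  ∑[ a < B ] 𝟙 (t ≟ 2 ^ a + 1) + ∑[ a < B ] ∑[ b < a ] 𝟙 (t ≟ 2 ^ a + 2 ^ suc b)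
  ≡ rep₂< B t + ∑[ a < B ] 𝟙 (t ≟ 2 ^ suc a)
pairs≥-by-lowest≡by-diagonal B t = begin
    ∑[ a < B ] 𝟙 (t ≟ 2 ^ a + 1) + ∑[ a < B ] ∑[ b < a ] 𝟙 (t ≟ 2 ^ a + 2 ^ suc b)
  ≡⟨ ∑-distrib-+ B (λ a → 𝟙 (t ≟ 2 ^ a + 1)) (λ a → ∑[ b < a ] 𝟙 (t ≟ 2 ^ a + 2 ^ suc b)) ⟨
    ∑[ a < B ] ∑[ b < suc a ] 𝟙 (t ≟ 2 ^ a + 2 ^ b)
  ≡⟨ ∑-cong B (λ a → trans (∑-last a (λ b → 𝟙 (t ≟ 2 ^ a + 2 ^ b)))
                           (cong (λ s → ∑[ b < a ] 𝟙 (t ≟ 2 ^ a + 2 ^ b) + 𝟙 (t ≟ s))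
                                 (2^n+2^n≡2^[1+n] a))) ⟩
    ∑[ a < B ] (∑[ b < a ] 𝟙 (t ≟ 2 ^ a + 2 ^ b) + 𝟙 (t ≟ 2 ^ suc a))
  ≡⟨ ∑-distrib-+ B (λ a → ∑[ b < a ] 𝟙 (t ≟ 2 ^ a + 2 ^ b)) (λ a → 𝟙 (t ≟ 2 ^ suc a)) ⟩
    rep₂< B t + ∑[ a < B ] 𝟙 (t ≟ 2 ^ suc a)
  ∎

rep₃-even-decomposition : ∀ B t →
  rep₃ (suc B) (2 * t) ≡ rep₃≥ B t + (rep₂< B t + ∑[ a < B ] 𝟙 (t ≟ 2 ^ suc a)) + 2 * rep₃< B t
rep₃-even-decomposition B t = begin
    rep₃ (suc B) (2 * t)
  ≡⟨ rep₃-even B t ⟩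
    C + rep₃ B t
  ≡⟨ cong (C +_) (rep₃-split B t) ⟩
    C + (rep₃≥ B t + (Y + 2 * rep₃< B t))
  ≡⟨ regroup C (rep₃≥ B t) Y (rep₃< B t) ⟩
    rep₃≥ B t + (C + Y) + 2 * rep₃< B t
  ≡⟨ cong (λ x → rep₃≥ B t + x + 2 * rep₃< B t) (pairs≥-by-lowest≡by-diagonal B t) ⟩
    rep₃≥ B t + (rep₂< B t + ∑[ a < B ] 𝟙 (t ≟ 2 ^ suc a)) + 2 * rep₃< B t
  ∎
  where
    C = ∑[ a < B ] 𝟙 (t ≟ 2 ^ a + 1)
    Y = ∑[ a < B ] ∑[ b < a ] 𝟙 (t ≟ 2 ^ a + 2 ^ suc b)
    regroup : ∀ c f y z → c + (f + (y + 2 * z)) ≡ f + (c + y) + 2 * z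
    regroup = solve-∀

rep₁-2^ : ∀ B j → j < B → rep₁ B (2 ^ j) ≡ 1
rep₁-2^ B j j<B = trans
  (∑-delta B (λ a → 𝟙 (2 ^ j ≟ 2 ^ a)) j j<B
             (λ a _ a≢j → 𝟙-no (2 ^ j ≟ 2 ^ a) (a≢j ∘ sym ∘ 2^-injective)))
  (𝟙-yes (2 ^ j ≟ 2 ^ j) refl)

rep₂<-2^ : ∀ B j → rep₂< B (2 ^ j) ≡ 0
rep₂<-2^ B j = ∑-zero B (λ a _ → ∑-zero a (λ b b<a →
  𝟙-no (2 ^ j ≟ 2 ^ a + 2 ^ b) (2^a+2^b≢2^c j b<a ∘ sym)))

rep₁-2^+2^ : ∀ B {p q} → q < p → rep₁ B (2 ^ p + 2 ^ q) ≡ 0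
rep₁-2^+2^ B {p} {q} q<p = ∑-zero B (λ a _ → 𝟙-no (2 ^ p + 2 ^ q ≟ 2 ^ a) (2^a+2^b≢2^c a q<p))

rep₂<-2^+2^ : ∀ B {p q} → q < p → p < B → rep₂< B (2 ^ p + 2 ^ q) ≡ 1
rep₂<-2^+2^ B {p} {q} q<p p<B = begin
    rep₂< B K
  ≡⟨ ∑-delta B (λ a → ∑[ b < a ] 𝟙 (K ≟ 2 ^ a + 2 ^ b)) p p<B (λ a _ a≢p → ∑-zero a (λ b b<a →
       𝟙-no (K ≟ 2 ^ a + 2 ^ b) (a≢p ∘ sym ∘ proj₁ ∘ 2^a+2^b-injective q<p b<a))) ⟩
    ∑[ b < p ] 𝟙 (K ≟ 2 ^ p + 2 ^ b)
  ≡⟨ ∑-delta p (λ b → 𝟙 (K ≟ 2 ^ p + 2 ^ b)) q q<p (λ b b<p b≢q →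
       𝟙-no (K ≟ 2 ^ p + 2 ^ b) (b≢q ∘ sym ∘ proj₂ ∘ 2^a+2^b-injective q<p b<p)) ⟩
    𝟙 (K ≟ K)
  ≡⟨ 𝟙-yes (K ≟ K) refl ⟩
    1
  ∎
  where
    K = 2 ^ p + 2 ^ q

-- Even and odd arguments

τ₁≡rep₁ : ∀ n → τ₁ n ≡ rep₁ (suc (suc n)) (suc n)
τ₁≡rep₁ n = begin
    τ₁ n
  ≡⟨ length-filter≡sum-𝟙 (λ s → suc n ≟ 2 ^ s) (range n) ⟩
    sum (map (λ s → 𝟙 (suc n ≟ 2 ^ s)) (range n))
  ≡⟨ sum-map-upTo (λ s → 𝟙 (suc n ≟ 2 ^ s)) (n + 2) ⟩
    rep₁ (n + 2) (suc n)
  ≡⟨ cong (λ B → rep₁ B (suc n)) (+-comm n 2) ⟩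
    rep₁ (suc (suc n)) (suc n)
  ∎

τ₂≡rep₂ : ∀ n → τ₂ n ≡ rep₂ (suc (suc n)) (suc n)
τ₂≡rep₂ n = begin
    τ₂ n
  ≡⟨ length-filter≡sum-𝟙 _ (cartesianProduct (range n) (range n)) ⟩
    sum (map (λ (s , u) → 𝟙 (suc n ≟ 2 ^ s + 2 ^ u)) (cartesianProduct (range n) (range n)))
  ≡⟨ sum-map-upTo² (n + 2) (λ s u → 𝟙 (suc n ≟ 2 ^ s + 2 ^ u)) ⟩
    rep₂ (n + 2) (suc n)
  ≡⟨ cong (λ B → rep₂ B (suc n)) (+-comm n 2) ⟩
    rep₂ (suc (suc n)) (suc n)
  ∎

τ₃≡rep₃≥ : ∀ n → τ₃ n ≡ rep₃≥ (suc (suc n)) (suc n)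
τ₃≡rep₃≥ n = begin
    τ₃ n
  ≡⟨ trans (length-filter≡sum-𝟙 _ triples)
           (cong sum (map-cong (λ (s , w , u) → 𝟙-τ₃-condition s w u) triples)) ⟩
    sum (map (λ (s , w , u) → ordered s w u) triples)
  ≡⟨ sum-map-upTo³ (n + 2) ordered ⟩
    ∑[ s < n + 2 ] ∑[ w < n + 2 ] ∑[ u < n + 2 ] ordered s w u
  ≡⟨ cong (λ B → ∑[ s < B ] ∑[ w < B ] ∑[ u < B ] ordered s w u) (+-comm n 2) ⟩
    ∑[ s < B ] ∑[ w < B ] ∑[ u < B ] ordered s w u
  ≡⟨ ∑-cong B (λ s → ∑-cong-< B (λ w w<B → below-middle s w (<⇒≤ w<B))) ⟩
    ∑[ s < B ] ∑[ w < B ] (𝟙 (w ≤? s) * ∑[ u < w ] 𝟙 (suc n ≟ 2 ^ s + 2 ^ w + 2 ^ u))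
  ≡⟨ ∑-comm B B (λ s w → 𝟙 (w ≤? s) * ∑[ u < w ] 𝟙 (suc n ≟ 2 ^ s + 2 ^ w + 2 ^ u)) ⟩
    rep₃≥ B (suc n)
  ∎
  where
    B = suc (suc n)
    triples : List (ℕ × ℕ × ℕ)
    triples = cartesianProduct (range n) (cartesianProduct (range n) (range n))
    ordered : ℕ → ℕ → ℕ → ℕ
    ordered s w u = 𝟙 (w ≤? s) * (𝟙 (u <? w) * 𝟙 (suc n ≟ 2 ^ s + 2 ^ w + 2 ^ u))
    𝟙-τ₃-condition : ∀ s w u →
      𝟙 ((w ≤? s) ×-dec ((u <? w) ×-dec (suc n ≟ 2 ^ s + 2 ^ w + 2 ^ u))) ≡ ordered s w u
    𝟙-τ₃-condition s w u = trans
      (𝟙-×-dec (w ≤? s) ((u <? w) ×-dec (suc n ≟ 2 ^ s + 2 ^ w + 2 ^ u)))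
      (cong (𝟙 (w ≤? s) *_) (𝟙-×-dec (u <? w) (suc n ≟ 2 ^ s + 2 ^ w + 2 ^ u)))
    below-middle : ∀ s w → w ≤ B →
      ∑[ u < B ] ordered s w u ≡ 𝟙 (w ≤? s) * ∑[ u < w ] 𝟙 (suc n ≟ 2 ^ s + 2 ^ w + 2 ^ u)
    below-middle s w w≤B = trans
      (∑-*-distribˡ B (𝟙 (w ≤? s)) (λ u → 𝟙 (u <? w) * 𝟙 (suc n ≟ 2 ^ s + 2 ^ w + 2 ^ u)))
      (cong (𝟙 (w ≤? s) *_) (∑-𝟙< B w (λ u → 𝟙 (suc n ≟ 2 ^ s + 2 ^ w + 2 ^ u)) w≤B))

v-double-mod4 : ∀ n → 3 ≤ n → v (2 * n) % 4 ≡ (2 * τ₃ n + τ₂ n + τ₁ n) % 4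
v-double-mod4 n 3≤n = begin
    v (2 * n) % 4
  ≡⟨ v-mod4 (2 * n) (suc B) 2t<2^[1+B] ⟩
    (rep₁ (suc B) (suc (2 * n)) + 2 * rep₃ (suc B) (suc (suc (2 * n)))) % 4
  ≡⟨ cong₂ (λ r T → (r + 2 * rep₃ (suc B) T) % 4) (rep₁-odd (suc B) n 0<n) 2+2n≡2t ⟩
    (2 * rep₃ (suc B) (2 * t)) % 4
  ≡⟨ cong (λ r → (2 * r) % 4) (rep₃-even-decomposition B t) ⟩
    (2 * (F + (P + D) + 2 * rep₃< B t)) % 4
  ≡⟨ +2*-cong-%4 0 (F + (P + D) + 2 * rep₃< B t) (F + (P + D)) ([m+2n]%2≡m%2 (F + (P + D)) (rep₃< B t)) ⟩
    (2 * (F + (P + D))) % 4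
  ≡⟨ cong (_% 4) (trans (expand F P D) (sym (cong₂ (λ r s → 2 * F + r + s) τ₂≡D+2P τ₁≡D))) ⟩
    (2 * rep₃≥ B t + τ₂ n + τ₁ n) % 4
  ≡⟨ cong (λ r → (2 * r + τ₂ n + τ₁ n) % 4) (τ₃≡rep₃≥ n) ⟨
    (2 * τ₃ n + τ₂ n + τ₁ n) % 4
  ∎
  where
    0<n : 0 < n
    0<n = ≤-trans (s≤s z≤n) 3≤n
    t = suc n
    B = suc (suc n)
    F = rep₃≥ B t
    P = rep₂< B t
    D = ∑[ a < B ] 𝟙 (t ≟ 2 ^ suc a)
    2+2n≡2t : suc (suc (2 * n)) ≡ 2 * t
    2+2n≡2t = sym (*-suc 2 n)
    t<2^B : t < 2 ^ B
    t<2^B = <-trans (n<1+n t) (n<2^n B)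
    2t<2^[1+B] : suc (suc (2 * n)) < 2 ^ suc B
    2t<2^[1+B] = subst (_< 2 ^ suc B) (sym 2+2n≡2t) (*-monoʳ-< 2 t<2^B)
    τ₁≡D : τ₁ n ≡ D
    τ₁≡D = trans (τ₁≡rep₁ n) (sym (rep₁-shift B t (>⇒≢ (s<s 0<n)) (<⇒≢ t<2^B)))
    τ₂≡D+2P : τ₂ n ≡ D + 2 * P
    τ₂≡D+2P = trans (τ₂≡rep₂ n) (rep₂-symmetric B t)
    expand : ∀ f p d → 2 * (f + (p + d)) ≡ 2 * f + (d + 2 * p) + d
    expand = solve-∀

2[1+k]∸1≡1+2k : ∀ k → 2 * suc k ∸ 1 ≡ suc (2 * k)
2[1+k]∸1≡1+2k k = cong (_∸ 1) (*-suc 2 k)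

v-odd-mod4 : ∀ K → 2 ≤ K → v (2 * K ∸ 1) % 4 ≡ (3 * rep₁ K K + 2 * rep₂< K K) % 4
v-odd-mod4 K@(suc k) 2≤K = begin
    v (2 * K ∸ 1) % 4
  ≡⟨ cong (λ m → v m % 4) (2[1+k]∸1≡1+2k k) ⟩
    v (suc (2 * k)) % 4
  ≡⟨ v-mod4 (suc (2 * k)) (suc K) (subst (λ x → suc x < 2 ^ suc K) (sym 2+2k≡2K) 1+2K<2^[1+K]) ⟩
    (rep₁ (suc K) (suc (suc (2 * k))) + 2 * rep₃ (suc K) (suc (suc (suc (2 * k))))) % 4
  ≡⟨ cong (λ x → (rep₁ (suc K) x + 2 * rep₃ (suc K) (suc x)) % 4) 2+2k≡2K ⟩
    (rep₁ (suc K) (2 * K) + 2 * rep₃ (suc K) (suc (2 * K))) % 4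
  ≡⟨ cong₂ (λ x y → (x + 2 * y) % 4) (rep₁-even K K) (rep₃-odd K K) ⟩
    (R + 2 * (rep₂ K K + P)) % 4
  ≡⟨ cong (λ y → (R + 2 * (y + P)) % 4) rep₂≡R+2P ⟩
    (R + 2 * (R + 2 * P + P)) % 4
  ≡⟨ cong (_% 4) (regroup R P) ⟩
    (3 * R + 2 * P + P * 4) % 4
  ≡⟨ [m+kn]%n≡m%n (3 * R + 2 * P) P 4 ⟩
    (3 * R + 2 * P) % 4
  ∎
  where
    R = rep₁ K K
    P = rep₂< K K
    2+2k≡2K : suc (suc (2 * k)) ≡ 2 * K
    2+2k≡2K = sym (*-suc 2 k)
    1+2K<2^[1+K] : suc (2 * K) < 2 ^ suc K
    1+2K<2^[1+K] = subst (_≤ 2 ^ suc K) (*-suc 2 K) (*-monoʳ-≤ 2 (n<2^n K))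
    rep₂≡R+2P : rep₂ K K ≡ R + 2 * P
    rep₂≡R+2P = trans (rep₂-symmetric K K) (cong (_+ 2 * P) (rep₁-shift K K (>⇒≢ 2≤K) (<⇒≢ (n<2^n K))))
    regroup : ∀ r p → r + 2 * (r + 2 * p + p) ≡ 3 * r + 2 * p + p * 4
    regroup = solve-∀

v-2^k∸1 : ∀ k → 2 ≤ k → v (2 ^ k ∸ 1) % 4 ≡ 3
v-2^k∸1 (suc zero)    (s≤s ())
v-2^k∸1 (suc (suc j)) _ = trans (v-odd-mod4 K (2≤2^[1+j] j))
  (cong₂ (λ r p → (3 * r + 2 * p) % 4) (rep₁-2^ K (suc j) (n<2^n (suc j))) (rep₂<-2^ K (suc j)))
  where
    K = 2 ^ suc j

v-2^k+2^l∸1 : ∀ k l → 1 ≤ l → l < k → v (2 ^ k + 2 ^ l ∸ 1) % 4 ≡ 2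
v-2^k+2^l∸1 (suc p) (suc q) _ (s<s q<p) = begin
    v (2 ^ suc p + 2 ^ suc q ∸ 1) % 4
  ≡⟨ cong (λ m → v (m ∸ 1) % 4) (2^[1+a]+2^[1+b]≡2[2^a+2^b] p q) ⟩
    v (2 * K ∸ 1) % 4
  ≡⟨ v-odd-mod4 K (≤-trans 2≤2^p (m≤m+n (2 ^ p) (2 ^ q))) ⟩
    (3 * rep₁ K K + 2 * rep₂< K K) % 4
  ≡⟨ cong₂ (λ r s → (3 * r + 2 * s) % 4) (rep₁-2^+2^ K q<p) (rep₂<-2^+2^ K q<p p<K) ⟩
    2
  ∎
  where
    K = 2 ^ p + 2 ^ q
    2≤2^p : 2 ≤ 2 ^ p
    2≤2^p = ^-monoʳ-≤ 2 (≤-trans (s≤s z≤n) q<p)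
    p<K : p < K
    p<K = <-≤-trans (n<2^n p) (m≤m+n (2 ^ p) (2 ^ q))

v-odd-otherwise : (m : ℕ) → m % 2 ≡ 1 → 3 ≤ m
  → ¬ (Σ ℕ (λ k → 2 ≤ k × m ≡ 2 ^ k ∸ 1))
  → ¬ (Σ ℕ (λ k → Σ ℕ (λ l → 1 ≤ l × l < k × m ≡ 2 ^ k + 2 ^ l ∸ 1)))
  → v m % 4 ≡ 0
v-odd-otherwise m m-odd 3≤m not-2^k∸1 not-2^k+2^l∸1 = begin
    v m % 4
  ≡⟨ cong (λ x → v x % 4) m≡2K∸1 ⟩
    v (2 * K ∸ 1) % 4
  ≡⟨ v-odd-mod4 K (s≤s 1≤h) ⟩
    (3 * rep₁ K K + 2 * rep₂< K K) % 4
  ≡⟨ cong₂ (λ r p → (3 * r + 2 * p) % 4) (∑-zero K (λ a _ → not-power a))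
                                         (∑-zero K (λ a _ → ∑-zero a (λ b b<a → not-sum a b b<a))) ⟩
    0
  ∎
  where
    h = m / 2
    K = suc h
    m≡1+2h : m ≡ suc (2 * h)
    m≡1+2h = trans (m≡m%n+[m/n]*n m 2) (cong₂ _+_ m-odd (*-comm h 2))
    m≡2K∸1 : m ≡ 2 * K ∸ 1
    m≡2K∸1 = trans m≡1+2h (sym (2[1+k]∸1≡1+2k h))
    1≤h : 1 ≤ h
    1≤h = *-cancelˡ-≤ 2 (≤-pred (subst (3 ≤_) m≡1+2h 3≤m))
    not-power : ∀ a → 𝟙 (K ≟ 2 ^ a) ≡ 0
    not-power zero    = 𝟙-no (K ≟ 1) (λ K≡1 → <⇒≢ (s≤s 1≤h) (sym K≡1))
    not-power (suc a) = 𝟙-no (K ≟ 2 ^ suc a) (λ K≡2^a →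
      not-2^k∸1 (suc (suc a) , s≤s (s≤s z≤n) , trans m≡2K∸1 (cong (λ x → 2 * x ∸ 1) K≡2^a)))
    not-sum : ∀ a b → b < a → 𝟙 (K ≟ 2 ^ a + 2 ^ b) ≡ 0
    not-sum a b b<a = 𝟙-no (K ≟ 2 ^ a + 2 ^ b) (λ K≡2^a+2^b →
      not-2^k+2^l∸1 (suc a , suc b , s≤s z≤n , s<s b<a ,
        trans m≡2K∸1 (trans (cong (λ x → 2 * x ∸ 1) K≡2^a+2^b)
                            (cong (_∸ 1) (sym (2^[1+a]+2^[1+b]≡2[2^a+2^b] a b))))))

proposition3 :
    ((n : ℕ) → 3 ≤ n → v (2 * n) % 4 ≡ (2 * τ₃ n + τ₂ n + τ₁ n) % 4)
    × (((k : ℕ) → 2 ≤ k → v (2 ^ k ∸ 1) % 4 ≡ 3)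
    × (((k l : ℕ) → 1 ≤ l → l < k → v (2 ^ k + 2 ^ l ∸ 1) % 4 ≡ 2)
    × ((m : ℕ) → m % 2 ≡ 1 → 3 ≤ m
        → ¬ (Σ ℕ (λ k → 2 ≤ k × m ≡ 2 ^ k ∸ 1))
        → ¬ (Σ ℕ (λ k → Σ ℕ (λ l → 1 ≤ l × l < k × m ≡ 2 ^ k + 2 ^ l ∸ 1)))
        → v m % 4 ≡ 0)))
proposition3 = v-double-mod4 , v-2^k∸1 , v-2^k+2^l∸1 , v-odd-otherwise
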